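{- Let $t$ be an infinite frieze and set $f_p=t(-1,p)$ and $g_p=t(0,p)$ for $p\in\mathbb{Z}$. Then for all $p,q\in\mathbb{Z}$, \[ t(p,q)=\left|\begin{array}{cc} f_p & f_q\\ g_p & g_q\end{array}\right| = f_pg_q-f_qg_p. \]
   Context: An infinite frieze is a map $t:\mathbb{Z}\times\mathbb{Z}\to\mathbb{Z}$ such that $t(i,i)=0$; $t(i,j)\ge 1$ if $i<j$ and $t(i,i+1)=1$; $t(i,j)=-t(j,i)$ for all $i,j$; and $t(i,j)t(i+1,j+1)-t(i,j+1)t(i+1,j)=1$ for all $i,j\in\mathbb{Z}$. -}

module Defs where

open import Data.Integer using (ℤ; _+_; _-_; _*_; -_; _<_; _≤_; +_; 0ℤ; 1ℤ)
open import Data.Product using (_×_)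
open import Relation.Binary.PropositionalEquality using (_≡_)

record IsInfiniteFrieze (t : ℤ → ℤ → ℤ) : Set where
  field
    diag      : ∀ i → t i i ≡ 0ℤ
    positive  : ∀ i j → i < j → 1ℤ ≤ t i j
    adjacent  : ∀ i → t i (i + 1ℤ) ≡ 1ℤ
    antisym   : ∀ i j → t i j ≡ - t j i
    unimodular : ∀ i j →
      t i j * t (i + 1ℤ) (j + 1ℤ) - t i (j + 1ℤ) * t (i + 1ℤ) j ≡ 1ℤ

module Submission where

-- For p ∈ ℤ put aₚ = t(p-1,p+1) and sₚ(q) = t(p-1,q) + t(p+1,q).
-- The unimodular rules for the index pairs (p-1, p) and (p, p+1) say that
-- the vectors (sₚ(q), t(p,q)) are proportional for consecutive q.  Since
-- sₚ(q) = aₚ·t(p,q) at q = p-1, p, p+1 and t(p,q) ≠ 0 for q ≠ p, this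
-- propagates to every q, giving the three-term recurrence
--   t(p-1,q) + t(p+1,q) = aₚ·t(p,q)
-- in the first index, and by antisymmetry also in the second index.  The
-- determinant D(p,q) = f_p g_q - f_q g_p is a linear combination of f and g,
-- hence obeys the same recurrence in p; it agrees with t(p,q) at p = -1, 0,
-- and a solution of a second-order recurrence is fixed by two consecutive
-- values.

open import Defs
open import Data.Integer using (ℤ; _-_; _*_; -_; 0ℤ; 1ℤ)
open import Relation.Binary.PropositionalEquality using (_≡_)

open import Data.Nat using (zero; suc)
import Data.Nat.Properties as ℕ
open import Data.Integer using (+_; _+_; _≤_; _<_; ∣_∣; +≤+; ≢-nonZero)
open import Data.Integer.Properties
open import Data.Integer.Tactic.RingSolver using (solve-∀)
open import Data.Sum using (inj₁; inj₂)
open import Data.Product using (_×_; _,_; proj₁)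
open import Relation.Binary.Definitions using (tri<; tri≈; tri>)
open import Relation.Binary.PropositionalEquality
  using (_≢_; refl; sym; trans; cong; cong₂; subst; module ≡-Reasoning)
open ≡-Reasoning

+1-1 : ∀ k → k + 1ℤ - 1ℤ ≡ k
+1-1 = solve-∀

-1+1 : ∀ k → k - 1ℤ + 1ℤ ≡ k
-1+1 = solve-∀

induction-from : (P : ℤ → Set) (r : ℤ) → P r →
  (∀ q → r ≤ q → P q → P (q + 1ℤ)) → ∀ q → r ≤ q → P q
induction-from P r base step q r≤q = subst P back-to-q (offset ∣ q - r ∣)
  where
  offset : ∀ n → P (r + + n)
  offset zero    = subst P (sym (+-identityʳ r)) base
  offset (suc n) = subst P one-more (step (r + + n) (i≤i+j r (+ n)) (offset n))
    where
    one-more : r + + n + 1ℤ ≡ r + + suc n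
    one-more = trans (+-assoc r (+ n) 1ℤ) (cong (λ m → r + + m) (ℕ.+-comm n 1))

  difference-cancels : ∀ r q → r + (q - r) ≡ q
  difference-cancels = solve-∀

  back-to-q : r + + ∣ q - r ∣ ≡ q
  back-to-q = trans (cong (λ m → r + m) (0≤i⇒+∣i∣≡i (i≤j⇒0≤j-i r≤q))) (difference-cancels r q)

induction-downfrom : (P : ℤ → Set) (r : ℤ) → P r →
  (∀ q → q ≤ r → P q → P (q - 1ℤ)) → ∀ q → q ≤ r → P q
induction-downfrom P r base step q q≤r =
  subst P (neg-involutive q)
    (induction-from (λ x → P (- x)) (- r) (subst P (sym (neg-involutive r)) base)
      step′ (- q) (neg-mono-≤ q≤r))
  where
  step′ : ∀ x → - r ≤ x → P (- x) → P (- (x + 1ℤ))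
  step′ x -r≤x Px = subst P (sym (neg-distrib-+ x 1ℤ))
    (step (- x) (subst (- x ≤_) (neg-involutive r) (neg-mono-≤ -r≤x)) Px)

ℤ-induction : (P : ℤ → Set) (r : ℤ) → P r →
  (∀ q → P q → P (q + 1ℤ)) → (∀ q → P q → P (q - 1ℤ)) → ∀ q → P q
ℤ-induction P r base up down q with ≤-total r q
... | inj₁ r≤q = induction-from P r base (λ k _ → up k) q r≤q
... | inj₂ q≤r = induction-downfrom P r base (λ k _ → down k) q q≤r

proportional-transfer : ∀ a {s₀ s₁ y₀ y₁} → y₀ ≢ 0ℤ →
  s₀ * y₁ ≡ s₁ * y₀ → s₀ ≡ a * y₀ → s₁ ≡ a * y₁
proportional-transfer a {s₀} {s₁} {y₀} {y₁} y₀≢0 cross refl =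
  *-cancelʳ-≡ s₁ (a * y₁) y₀ {{≢-nonZero y₀≢0}} (begin
    s₁ * y₀     ≡⟨ sym cross ⟩
    a * y₀ * y₁ ≡⟨ reorder a y₀ y₁ ⟩
    a * y₁ * y₀ ∎)
  where
  reorder : ∀ a y₀ y₁ → a * y₀ * y₁ ≡ a * y₁ * y₀
  reorder = solve-∀

outer-sum-proportional : ∀ x₀ x₁ y₀ y₁ z₀ z₁ →
  x₀ * y₁ - x₁ * y₀ ≡ 1ℤ → y₀ * z₁ - y₁ * z₀ ≡ 1ℤ →
  (x₀ + z₀) * y₁ ≡ (x₁ + z₁) * y₀
outer-sum-proportional x₀ x₁ y₀ y₁ z₀ z₁ det-xy det-yz = i-j≡0⇒i≡j _ _ (begin
  (x₀ + z₀) * y₁ - (x₁ + z₁) * y₀         ≡⟨ expand x₀ x₁ y₀ y₁ z₀ z₁ ⟩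
  (x₀ * y₁ - x₁ * y₀) - (y₀ * z₁ - y₁ * z₀) ≡⟨ cong₂ _-_ det-xy det-yz ⟩
  0ℤ                                       ∎)
  where
  expand : ∀ x₀ x₁ y₀ y₁ z₀ z₁ → (x₀ + z₀) * y₁ - (x₁ + z₁) * y₀
         ≡ (x₀ * y₁ - x₁ * y₀) - (y₀ * z₁ - y₁ * z₀)
  expand = solve-∀

Recurrence : (ℤ → ℤ) → (ℤ → ℤ) → Set
Recurrence a u = ∀ k → u (k - 1ℤ) + u (k + 1ℤ) ≡ a k * u k

recurrence-combination : ∀ a f g → Recurrence a f → Recurrence a g →
  ∀ c d → Recurrence a (λ k → f k * c - d * g k)
recurrence-combination a f g rec-f rec-g c d k = begin
  (f (k - 1ℤ) * c - d * g (k - 1ℤ)) + (f (k + 1ℤ) * c - d * g (k + 1ℤ))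
    ≡⟨ regroup (f (k - 1ℤ)) (f (k + 1ℤ)) (g (k - 1ℤ)) (g (k + 1ℤ)) c d ⟩
  (f (k - 1ℤ) + f (k + 1ℤ)) * c - d * (g (k - 1ℤ) + g (k + 1ℤ))
    ≡⟨ cong₂ (λ F G → F * c - d * G) (rec-f k) (rec-g k) ⟩
  a k * f k * c - d * (a k * g k)
    ≡⟨ factor (a k) (f k) (g k) c d ⟩
  a k * (f k * c - d * g k) ∎
  where
  regroup : ∀ f₋ f₊ g₋ g₊ c d → (f₋ * c - d * g₋) + (f₊ * c - d * g₊)
          ≡ (f₋ + f₊) * c - d * (g₋ + g₊)
  regroup = solve-∀
  factor : ∀ a f g c d → a * f * c - d * (a * g) ≡ a * (f * c - d * g)
  factor = solve-∀

recurrence-uniqueness : ∀ a u v → Recurrence a u → Recurrence a v → ∀ r →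
  u r ≡ v r → u (r + 1ℤ) ≡ v (r + 1ℤ) → ∀ k → u k ≡ v k
recurrence-uniqueness a u v rec-u rec-v r agree₀ agree₁ k =
  proj₁ (ℤ-induction AgreePair r (agree₀ , agree₁) up down k)
  where
  Agree : ℤ → Set
  Agree k = u k ≡ v k

  AgreePair : ℤ → Set
  AgreePair k = Agree k × Agree (k + 1ℤ)

  solve-forward : ∀ {w} → Recurrence a w → ∀ k → w (k + 1ℤ) ≡ a k * w k - w (k - 1ℤ)
  solve-forward {w} rec k = trans (isolate (w (k - 1ℤ)) (w (k + 1ℤ))) (cong (_- w (k - 1ℤ)) (rec k))
    where
    isolate : ∀ x y → y ≡ (x + y) - x
    isolate = solve-∀

  solve-backward : ∀ {w} → Recurrence a w → ∀ k → w (k - 1ℤ) ≡ a k * w k - w (k + 1ℤ)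
  solve-backward {w} rec k = trans (isolate (w (k - 1ℤ)) (w (k + 1ℤ))) (cong (_- w (k + 1ℤ)) (rec k))
    where
    isolate : ∀ x y → x ≡ (x + y) - y
    isolate = solve-∀

  agree-forward : ∀ k → Agree (k - 1ℤ) → Agree k → Agree (k + 1ℤ)
  agree-forward k e₋ e = begin
    u (k + 1ℤ)               ≡⟨ solve-forward rec-u k ⟩
    a k * u k - u (k - 1ℤ)   ≡⟨ cong₂ (λ x y → a k * x - y) e e₋ ⟩
    a k * v k - v (k - 1ℤ)   ≡⟨ solve-forward rec-v k ⟨
    v (k + 1ℤ)               ∎

  agree-backward : ∀ k → Agree k → Agree (k + 1ℤ) → Agree (k - 1ℤ)
  agree-backward k e e₊ = begin
    u (k - 1ℤ)               ≡⟨ solve-backward rec-u k ⟩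
    a k * u k - u (k + 1ℤ)   ≡⟨ cong₂ (λ x y → a k * x - y) e e₊ ⟩
    a k * v k - v (k + 1ℤ)   ≡⟨ solve-backward rec-v k ⟨
    v (k - 1ℤ)               ∎

  up : ∀ k → AgreePair k → AgreePair (k + 1ℤ)
  up k (e , e₊) = e₊ , agree-forward (k + 1ℤ) (subst Agree (sym (+1-1 k)) e) e₊

  down : ∀ k → AgreePair k → AgreePair (k - 1ℤ)
  down k (e , e₊) = agree-backward k e e₊ , subst Agree (sym (-1+1 k)) e

module FriezeRecurrence (t : ℤ → ℤ → ℤ) (frieze : IsInfiniteFrieze t) where
  open IsInfiniteFrieze frieze

  coefficient : ℤ → ℤ
  coefficient p = t (p - 1ℤ) (p + 1ℤ)

  adjacent-below : ∀ p → t (p - 1ℤ) p ≡ 1ℤ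
  adjacent-below p = subst (λ r → t (p - 1ℤ) r ≡ 1ℤ) (-1+1 p) (adjacent (p - 1ℤ))

  nonzero-above : ∀ {p q} → p < q → t p q ≢ 0ℤ
  nonzero-above {p} {q} p<q t≡0 with subst (1ℤ ≤_) t≡0 (positive p q p<q)
  ... | +≤+ ()

  nonzero-below : ∀ {p q} → q < p → t p q ≢ 0ℤ
  nonzero-below {p} {q} q<p t≡0 = nonzero-above q<p (begin
    t q p     ≡⟨ neg-involutive (t q p) ⟨
    - - t q p ≡⟨ cong -_ (antisym p q) ⟨
    - t p q   ≡⟨ cong -_ t≡0 ⟩
    0ℤ        ∎)

  module Row (p : ℤ) where
    neighbourSum : ℤ → ℤ
    neighbourSum q = t (p - 1ℤ) q + t (p + 1ℤ) q

    Proportional : ℤ → Set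
    Proportional q = neighbourSum q ≡ coefficient p * t p q

    cross : ∀ q → neighbourSum q * t p (q + 1ℤ) ≡ neighbourSum (q + 1ℤ) * t p q
    cross q = outer-sum-proportional
      (t (p - 1ℤ) q) (t (p - 1ℤ) (q + 1ℤ)) (t p q) (t p (q + 1ℤ))
      (t (p + 1ℤ) q) (t (p + 1ℤ) (q + 1ℤ))
      (subst (λ r → t (p - 1ℤ) q * t r (q + 1ℤ) - t (p - 1ℤ) (q + 1ℤ) * t r q ≡ 1ℤ)
        (-1+1 p) (unimodular (p - 1ℤ) q))
      (unimodular p q)

    -- At q = p-1, p, p+1 the relation reads -aₚ = aₚ·(-1), 0 = aₚ·0, aₚ = aₚ·1.
    at-diagonal : Proportional p
    at-diagonal rewrite adjacent-below p | antisym (p + 1ℤ) p | adjacent p | diag p =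
      sym (*-zeroʳ (coefficient p))

    at-next : Proportional (p + 1ℤ)
    at-next rewrite diag (p + 1ℤ) | adjacent p =
      trans (+-identityʳ (coefficient p)) (sym (*-identityʳ (coefficient p)))

    at-previous : Proportional (p - 1ℤ)
    at-previous
      rewrite diag (p - 1ℤ) | antisym (p + 1ℤ) (p - 1ℤ) | antisym p (p - 1ℤ) | adjacent-below p =
      negate (coefficient p)
      where
      negate : ∀ a → 0ℤ + - a ≡ a * - 1ℤ
      negate = solve-∀

    -- Propagation to the right of p+1 and to the left of p-1, where t(p,q) ≠ 0.
    right-of : ∀ q → p + 1ℤ ≤ q → Proportional q
    right-of = induction-from Proportional (p + 1ℤ) at-next λ q p+1≤q →
      proportional-transfer (coefficient p)
        (nonzero-above (suc[i]≤j⇒i<j (subst (_≤ q) (+-comm p 1ℤ) p+1≤q))) (cross q)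

    left-of : ∀ q → q ≤ p - 1ℤ → Proportional q
    left-of = induction-downfrom Proportional (p - 1ℤ) at-previous λ q q≤p-1 →
      proportional-transfer (coefficient p)
        (nonzero-below (i≤pred[j]⇒i<j (subst (q ≤_) (+-comm p (- 1ℤ)) q≤p-1)))
        (sym (subst (λ r → neighbourSum (q - 1ℤ) * t p r ≡ neighbourSum r * t p (q - 1ℤ))
          (-1+1 q) (cross (q - 1ℤ))))

    everywhere : ∀ q → Proportional q
    everywhere q with <-cmp q p
    ... | tri< q<p _ _ = left-of q (subst (q ≤_) (+-comm (- 1ℤ) p) (i<j⇒i≤pred[j] q<p))
    ... | tri≈ _ refl _ = at-diagonal
    ... | tri> _ _ p<q = right-of q (subst (_≤ q) (+-comm 1ℤ p) (i<j⇒suc[i]≤j p<q))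

  first-index-recurrence : ∀ q → Recurrence coefficient (λ k → t k q)
  first-index-recurrence q k = Row.everywhere k q

  second-index-recurrence : ∀ r → Recurrence coefficient (t r)
  second-index-recurrence r k = begin
    t r (k - 1ℤ) + t r (k + 1ℤ)           ≡⟨ cong₂ _+_ (antisym r (k - 1ℤ)) (antisym r (k + 1ℤ)) ⟩
    - t (k - 1ℤ) r + - t (k + 1ℤ) r       ≡⟨ neg-distrib-+ (t (k - 1ℤ) r) (t (k + 1ℤ) r) ⟨
    - (t (k - 1ℤ) r + t (k + 1ℤ) r)       ≡⟨ cong -_ (Row.everywhere k r) ⟩
    - (coefficient k * t k r)             ≡⟨ neg-distribʳ-* (coefficient k) (t k r) ⟩
    coefficient k * - t k r               ≡⟨ cong (coefficient k *_) (antisym r k) ⟨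
    coefficient k * t r k                 ∎

lemma1p8 : (t : ℤ → ℤ → ℤ) → IsInfiniteFrieze t →
    ∀ p q → t p q ≡ t (- 1ℤ) p * t 0ℤ q - t (- 1ℤ) q * t 0ℤ p
lemma1p8 t frieze p q =
  recurrence-uniqueness coefficient
    (λ k → t k q) (λ k → t (- 1ℤ) k * t 0ℤ q - t (- 1ℤ) q * t 0ℤ k)
    (first-index-recurrence q)
    (recurrence-combination coefficient (t (- 1ℤ)) (t 0ℤ)
      (second-index-recurrence (- 1ℤ)) (second-index-recurrence 0ℤ) (t 0ℤ q) (t (- 1ℤ) q))
    (- 1ℤ) at-minus-one at-zero p
  where
  open IsInfiniteFrieze frieze
  open FriezeRecurrence t frieze

  -- t(-1,-1) = 0 and t(0,-1) = -1.
  at-minus-one : t (- 1ℤ) q ≡ t (- 1ℤ) (- 1ℤ) * t 0ℤ q - t (- 1ℤ) q * t 0ℤ (- 1ℤ)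
  at-minus-one rewrite diag (- 1ℤ) | antisym 0ℤ (- 1ℤ) | adjacent (- 1ℤ) =
    value-at-minus-one (t (- 1ℤ) q) (t 0ℤ q)
    where
    value-at-minus-one : ∀ f g → f ≡ 0ℤ * g - f * - 1ℤ
    value-at-minus-one = solve-∀

  -- t(-1,0) = 1 and t(0,0) = 0.
  at-zero : t 0ℤ q ≡ t (- 1ℤ) 0ℤ * t 0ℤ q - t (- 1ℤ) q * t 0ℤ 0ℤ
  at-zero rewrite diag 0ℤ | adjacent (- 1ℤ) = value-at-zero (t (- 1ℤ) q) (t 0ℤ q)
    where
    value-at-zero : ∀ f g → g ≡ 1ℤ * g - f * 0ℤ
    value-at-zero = solve-∀
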